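{- Let $D$ be a directed cycle on $n$ vertices. Then $\mathrm{Dlf}(D)=\mathrm{DT}(D)$, and this complex is vertex decomposable.
   Context: A multidigraph $D$ consists of finite sets $V(D)$, $E(D)$ and maps $s,t:E(D)\to V(D)$. A directed cycle is a connected digraph (no two distinct edges with the same source and same target) in which every vertex has in-degree and out-degree $1$. A directed path is obtained from a directed cycle by removing one edge. A directed forest is a digraph with no directed cycles in which no two distinct edges share the same target. For $\sigma\subseteq E(D)$, $D[\sigma]$ is the multidigraph with edge set $\sigma$ and vertex set the endpoints of edges of $\sigma$. $\mathrm{Dlf}(D)$ (resp. $\mathrm{DT}(D)$) is the simplicial complex on $E(D)$ whose faces are the $\sigma$ with $D[\sigma]$ a vertex-disjoint union of directed paths (resp. a directed forest). A simplicial complex $\Delta$ is vertex decomposable if it is a simplex (including the void complex and $\{\emptyset\}$), or there is a vertex $v$ with $\mathrm{lk}_\Delta(v)$ and $\mathrm{del}_\Delta(v)$ vertex decomposable and every facet of $\mathrm{del}_\Delta(v)$ a facet of $\Delta$. -}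

module Defs where

open import Data.Nat using (ℕ; suc; NonZero)
open import Data.Nat.DivMod using (_mod_)
open import Data.Fin using (Fin; toℕ)
open import Data.Fin.Subset using (Subset; _∈_; _∉_; _⊆_; ⁅_⁆; _∪_)
open import Data.List using (List; []; _∷_; map; _∷ʳ_)
open import Data.List.Relation.Unary.All using (All)
open import Data.List.Relation.Unary.Any using (Any)
open import Data.List.Relation.Unary.Unique.Propositional using (Unique)
open import Data.List.Relation.Unary.AllPairs using (AllPairs)
import Data.List.Membership.Propositional as LM
open import Data.Product using (Σ; ∃; ∃-syntax; _×_; _,_)
open import Data.Sum using (_⊎_)
open import Data.Unit using (⊤)
open import Data.Empty using (⊥)
open import Relation.Nullary using (¬_)
open import Relation.Binary.PropositionalEquality using (_≡_; _≢_)
open import Function.Bundles using (_⇔_)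

record Multidigraph : Set where
  field
    nV  : ℕ
    nE  : ℕ
    src : Fin nE → Fin nV
    tgt : Fin nE → Fin nV
open Multidigraph public

Complex : ℕ → Set₁
Complex n = Subset n → Set

module _ (D : Multidigraph) where
  private
    E = Fin (nE D)
    s = src D
    t = tgt D

  Chain : List E → Set
  Chain []            = ⊤
  Chain (e ∷ [])      = ⊤
  Chain (e ∷ f ∷ es)  = t e ≡ s f × Chain (f ∷ es)

  pathVerts : E → List E → List (Fin (nV D))
  pathVerts e es = s e ∷ map t (e ∷ es)

  IsDirPath : E → List E → Set
  IsDirPath e es = Chain (e ∷ es) × Unique (pathVerts e es)

  IsDirCycle : E → List E → Set
  IsDirCycle e es = Chain ((e ∷ es) ∷ʳ e) × Unique (map s (e ∷ es))

  HasDirCycle : Subset (nE D) → Set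
  HasDirCycle σ = ∃[ e ] ∃[ es ] (IsDirCycle e es × e ∈ σ × All (_∈ σ) es)

  DPath : Set
  DPath = E × List E

  pEdges : DPath → List E
  pEdges (e , es) = e ∷ es

  pVerts : DPath → List (Fin (nV D))
  pVerts (e , es) = pathVerts e es

  VertexDisjoint : DPath → DPath → Set
  VertexDisjoint P Q = ∀ v → v LM.∈ pVerts P → v LM.∈ pVerts Q → ⊥

  Dlf : Complex (nE D)
  Dlf σ = ∃[ Ps ] ( All (λ P → IsDirPath (Data.Product.proj₁ P) (Data.Product.proj₂ P)) Ps
                  × AllPairs VertexDisjoint Ps
                  × (∀ e → e ∈ σ ⇔ Any (λ P → e LM.∈ pEdges P) Ps))

  -- DT(D): D[σ] is a directed forest
  DT : Complex (nE D)
  DT σ = ¬ HasDirCycle σ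
       × (∀ e f → e ∈ σ → f ∈ σ → t e ≡ t f → e ≡ f)

cycleDigraph : (n : ℕ) .{{_ : NonZero n}} → Multidigraph
cycleDigraph n = record { nV = n ; nE = n ; src = λ i → i ; tgt = λ i → suc (toℕ i) mod n }

lk : ∀ {n} → Complex n → Fin n → Complex n
lk Δ v σ = v ∉ σ × Δ (σ ∪ ⁅ v ⁆)

del : ∀ {n} → Complex n → Fin n → Complex n
del Δ v σ = v ∉ σ × Δ σ

IsFacet : ∀ {n} → Complex n → Subset n → Set
IsFacet Δ σ = Δ σ × (∀ τ → Δ τ → σ ⊆ τ → τ ⊆ σ)

-- a simplex: the void complex, or all subsets of some τ (τ = ∅ gives {∅})
IsSimplex : ∀ {n} → Complex n → Set
IsSimplex {n} Δ = (∀ σ → ¬ Δ σ) ⊎ (∃[ τ ] ∀ σ → Δ σ ⇔ σ ⊆ τ)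

data VertexDecomposable {n : ℕ} : Complex n → Set₁ where
  simplex : ∀ {Δ} → IsSimplex Δ → VertexDecomposable Δ
  shed    : ∀ {Δ} (v : Fin n) → Δ ⁅ v ⁆
          → VertexDecomposable (lk Δ v)
          → VertexDecomposable (del Δ v)
          → (∀ σ → IsFacet (del Δ v) σ → IsFacet Δ σ)
          → VertexDecomposable Δ

-- On the directed cycle every vertex has in-degree one, so the in-degree condition of DT
-- holds for every edge set, and the only directed cycle is the whole cycle: DT consists of
-- the proper subsets of the edges. So does Dlf: a nonempty linear forest has an edge ending
-- at a vertex without outgoing edge, which cannot happen when all edges are present, while
-- removing an edge i leaves the Hamiltonian path starting at i + 1, and any set of edges of
-- a path splits into its maximal runs, which are vertex-disjoint paths. Both complexes are
-- therefore the boundary of a simplex, which is vertex decomposable: shedding a vertex v, the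
-- link is the boundary of the simplex on the other vertices and the deletion is that simplex.

module Submission where

open import Defs
open import Data.Nat using (ℕ; zero; suc; _+_; _∸_; _≤_; _<_; z≤n; s≤s; s≤s⁻¹; NonZero; _%_)
open import Data.Nat.Properties
  using (≤-refl; ≤-trans; ≤-reflexive; <-irrefl; ≤⇒≯; n≤1+n; <⇒≤; <⇒≢; <-trans; m≤n⇒m<n∨m≡n;
         +-comm; +-assoc; +-suc; +-identityʳ; m≤n+m; m+[n∸m]≡n)
open import Data.Nat.DivMod using (_mod_; %-distribˡ-+; m%n%n≡m%n; [m+n]%n≡m%n; m<n⇒m%n≡m; m%n<n)
open import Data.Nat.Induction using (<-wellFounded)
open import Data.Fin using (Fin; zero; suc; toℕ; _≟_)
open import Data.Fin.Properties using (toℕ-injective; toℕ-fromℕ<; toℕ<n; ¬∀⟶∃¬)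
open import Data.Fin.Subset using (Subset; _∈_; _∉_; _⊆_; _⊂_; ⁅_⁆; _-_; ⊥; ⊤; ∣_∣; Nonempty)
open import Data.Fin.Subset.Properties
  using (_∈?_; nonempty?; x∈p∧x≢y⇒x∈p-y; p─q⊆p; x∈p⇒∣p-x∣<∣p∣; x∈⁅x⁆; x∈⁅y⁆⇒x≡y; x∈p∪q⁺; x∈p∪q⁻;
         ∉⊥; ∈⊤; ⊆⊤)
open import Data.Vec.Base using (_∷_; there)
open import Data.List using (List; []; _∷_; map; _∷ʳ_; applyUpTo)
open import Data.List.Properties using (applyUpTo-∷ʳ; map-id)
open import Data.List.Relation.Unary.All as All using (All; []; _∷_)
open import Data.List.Relation.Unary.Any using (Any; here; there)
open import Data.List.Relation.Unary.AllPairs using (AllPairs; []; _∷_)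
open import Data.List.Relation.Unary.Unique.Propositional using (Unique)
open import Data.List.Relation.Unary.Unique.Propositional.Properties using (applyUpTo⁺₁)
open import Data.List.Relation.Binary.Permutation.Propositional using (↭-sym)
open import Data.List.Relation.Binary.Permutation.Propositional.Properties using (∈-resp-↭; ∷↭∷ʳ)
open import Data.List.Membership.Propositional using () renaming (_∈_ to _∈ₗ_)
open import Data.List.Membership.Propositional.Properties using (∈-map⁺)
open import Data.Product using (∃; ∃-syntax; _×_; _,_; proj₁; proj₂; map₂)
open import Data.Sum using (_⊎_; inj₁; inj₂; [_,_])
open import Data.Unit using (tt) renaming (⊤ to ⊤ᵤ)
open import Data.Empty using (⊥-elim)
open import Function using (_∘_; id)
open import Function.Bundles using (_⇔_; mk⇔; Equivalence)
open import Function.Construct.Symmetry using (⇔-sym)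
open import Function.Construct.Composition using (_⇔-∘_)
open import Induction.WellFounded using (Acc; acc)
open import Relation.Nullary using (¬_; yes; no)
open import Relation.Binary.PropositionalEquality
  using (_≡_; _≢_; refl; sym; trans; cong; subst; module ≡-Reasoning)

open Equivalence using (to; from)
open ≡-Reasoning

[m%d+n]%d≡[m+n]%d : ∀ m n d .{{_ : NonZero d}} → (m % d + n) % d ≡ (m + n) % d
[m%d+n]%d≡[m+n]%d m n d = begin
  (m % d + n) % d         ≡⟨ %-distribˡ-+ (m % d) n d ⟩
  (m % d % d + n % d) % d ≡⟨ cong (λ a → (a + n % d) % d) (m%n%n≡m%n m d) ⟩
  (m % d + n % d) % d     ≡⟨ %-distribˡ-+ m n d ⟨
  (m + n) % d             ∎

[m+n%d]%d≡[m+n]%d : ∀ m n d .{{_ : NonZero d}} → (m + n % d) % d ≡ (m + n) % d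
[m+n%d]%d≡[m+n]%d m n d = begin
  (m + n % d) % d ≡⟨ cong (_% d) (+-comm m (n % d)) ⟩
  (n % d + m) % d ≡⟨ [m%d+n]%d≡[m+n]%d n m d ⟩
  (n + m) % d     ≡⟨ cong (_% d) (+-comm n m) ⟩
  (m + n) % d     ∎

m+[k+[n∸m]]≡k+n : ∀ {m n} → m ≤ n → ∀ k → m + (k + (n ∸ m)) ≡ k + n
m+[k+[n∸m]]≡k+n {m} {n} m≤n k = begin
  m + (k + (n ∸ m)) ≡⟨ +-assoc m k (n ∸ m) ⟨
  m + k + (n ∸ m)   ≡⟨ cong (_+ (n ∸ m)) (+-comm m k) ⟩
  k + m + (n ∸ m)   ≡⟨ +-assoc k m (n ∸ m) ⟩
  k + (m + (n ∸ m)) ≡⟨ cong (k +_) (m+[n∸m]≡n m≤n) ⟩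
  k + n             ∎

-- Boundaries of simplices

private variable
  n : ℕ

infix 4 _≋_
_≋_ : Complex n → Complex n → Set
Δ ≋ Γ = ∀ σ → Δ σ ⇔ Γ σ

≋-sym : {Δ Γ : Complex n} → Δ ≋ Γ → Γ ≋ Δ
≋-sym Δ≋Γ σ = ⇔-sym (Δ≋Γ σ)

IsSimplex-resp : {Δ Γ : Complex n} → Δ ≋ Γ → IsSimplex Δ → IsSimplex Γ
IsSimplex-resp Δ≋Γ (inj₁ void)           = inj₁ (λ σ Γσ → void σ (from (Δ≋Γ σ) Γσ))
IsSimplex-resp Δ≋Γ (inj₂ (τ , Δ≋⊆τ)) = inj₂ (τ , λ σ → Δ≋⊆τ σ ⇔-∘ ⇔-sym (Δ≋Γ σ))

IsFacet-resp : {Δ Γ : Complex n} → Δ ≋ Γ → ∀ {σ} → IsFacet Δ σ → IsFacet Γ σ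
IsFacet-resp Δ≋Γ (Δσ , maximal) = to (Δ≋Γ _) Δσ , λ τ Γτ → maximal τ (from (Δ≋Γ τ) Γτ)

lk-resp : {Δ Γ : Complex n} → Δ ≋ Γ → ∀ v → lk Δ v ≋ lk Γ v
lk-resp Δ≋Γ v σ = mk⇔ (map₂ (to (Δ≋Γ _))) (map₂ (from (Δ≋Γ _)))

del-resp : {Δ Γ : Complex n} → Δ ≋ Γ → ∀ v → del Δ v ≋ del Γ v
del-resp Δ≋Γ v σ = mk⇔ (map₂ (to (Δ≋Γ σ))) (map₂ (from (Δ≋Γ σ)))

VertexDecomposable-resp : {Δ Γ : Complex n} → Δ ≋ Γ → VertexDecomposable Δ → VertexDecomposable Γ
VertexDecomposable-resp Δ≋Γ (simplex Δ-simplex) = simplex (IsSimplex-resp Δ≋Γ Δ-simplex)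
VertexDecomposable-resp Δ≋Γ (shed v Δv lk-vd del-vd del-facets) =
  shed v (to (Δ≋Γ _) Δv)
    (VertexDecomposable-resp (lk-resp Δ≋Γ v) lk-vd)
    (VertexDecomposable-resp (del-resp Δ≋Γ v) del-vd)
    (λ σ → IsFacet-resp Δ≋Γ ∘ del-facets σ ∘ IsFacet-resp (≋-sym (del-resp Δ≋Γ v)))

x∉p-x : (p : Subset n) (x : Fin n) → x ∉ p - x
x∉p-x (_ ∷ p) (suc x) (there x∈p-x) = x∉p-x p x x∈p-x

module _ {p : Subset n} {y : Fin n} where

  x∈p-y⇒x≢y : ∀ {x} → x ∈ p - y → x ≢ y
  x∈p-y⇒x≢y x∈p-y refl = x∉p-x p y x∈p-y

  p-y⊆p : p - y ⊆ p
  p-y⊆p = p─q⊆p p ⁅ y ⁆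

  x∈p⇒x≡y⊎x∈p-y : ∀ {x} → x ∈ p → x ≡ y ⊎ x ∈ p - y
  x∈p⇒x≡y⊎x∈p-y {x} x∈p with x ≟ y
  ... | yes x≡y = inj₁ x≡y
  ... | no  x≢y = inj₂ (x∈p∧x≢y⇒x∈p-y x∈p x≢y)

  y∉q⊆p-y : ∀ {q} → q ⊆ p - y → y ∉ q
  y∉q⊆p-y q⊆p-y y∈q = x∉p-x p y (q⊆p-y y∈q)

module _ {τ : Subset n} where

  ⊂-empty : ¬ Nonempty τ → ∀ σ → ¬ σ ⊂ τ
  ⊂-empty τ-empty σ (_ , i , i∈τ , _) = τ-empty (i , i∈τ)

  ⊂-singleton : ∀ {v} → v ∈ τ → ¬ Nonempty (τ - v) → (_⊂ τ) ≋ (_⊆ ⊥)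
  ⊂-singleton {v} v∈τ τ-v-empty σ = mk⇔ σ⊆⊥ (λ σ⊆⊥ → ⊥-elim ∘ ∉⊥ ∘ σ⊆⊥ , v , v∈τ , ∉⊥ ∘ σ⊆⊥)
    where
    σ⊆⊥ : σ ⊂ τ → σ ⊆ ⊥
    σ⊆⊥ (σ⊆τ , i , i∈τ , i∉σ) x∈σ with x∈p⇒x≡y⊎x∈p-y {y = v} (σ⊆τ x∈σ) | x∈p⇒x≡y⊎x∈p-y {y = v} i∈τ
    ... | inj₂ x∈τ-v | _           = ⊥-elim (τ-v-empty (_ , x∈τ-v))
    ... | inj₁ refl  | inj₁ refl   = ⊥-elim (i∉σ x∈σ)
    ... | inj₁ refl  | inj₂ i∈τ-v  = ⊥-elim (τ-v-empty (i , i∈τ-v))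

  module _ {v : Fin n} (v∈τ : v ∈ τ) where

    ⁅v⁆⊆τ : ⁅ v ⁆ ⊆ τ
    ⁅v⁆⊆τ x∈⁅v⁆ = subst (_∈ τ) (sym (x∈⁅y⁆⇒x≡y v x∈⁅v⁆)) v∈τ

    ⁅⁆⊂ : ∀ {u} → u ∈ τ - v → ⁅ v ⁆ ⊂ τ
    ⁅⁆⊂ {u} u∈τ-v = ⁅v⁆⊆τ , u , p-y⊆p u∈τ-v , x∈p-y⇒x≢y u∈τ-v ∘ x∈⁅y⁆⇒x≡y v

    lk-⊂ : lk (_⊂ τ) v ≋ (_⊂ τ - v)
    lk-⊂ σ = mk⇔ to′ from′
      where
      to′ : lk (_⊂ τ) v σ → σ ⊂ τ - v
      to′ (v∉σ , σ∪v⊆τ , i , i∈τ , i∉σ∪v) =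
          (λ x∈σ → x∈p∧x≢y⇒x∈p-y (σ∪v⊆τ (x∈p∪q⁺ (inj₁ x∈σ))) λ { refl → v∉σ x∈σ })
        , i , x∈p∧x≢y⇒x∈p-y i∈τ (λ { refl → i∉σ∪v (x∈p∪q⁺ (inj₂ (x∈⁅x⁆ v))) })
        , i∉σ∪v ∘ x∈p∪q⁺ ∘ inj₁
      from′ : σ ⊂ τ - v → lk (_⊂ τ) v σ
      from′ (σ⊆τ-v , i , i∈τ-v , i∉σ) =
          y∉q⊆p-y σ⊆τ-v
        , [ p-y⊆p ∘ σ⊆τ-v , ⁅v⁆⊆τ ] ∘ x∈p∪q⁻ σ ⁅ v ⁆
        , i , p-y⊆p i∈τ-v
        , [ i∉σ , x∈p-y⇒x≢y i∈τ-v ∘ x∈⁅y⁆⇒x≡y v ] ∘ x∈p∪q⁻ σ ⁅ v ⁆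

    del-⊂ : del (_⊂ τ) v ≋ (_⊆ τ - v)
    del-⊂ σ = mk⇔ (λ (v∉σ , σ⊆τ , _) x∈σ → x∈p∧x≢y⇒x∈p-y (σ⊆τ x∈σ) λ { refl → v∉σ x∈σ }) from′
      where
      from′ : σ ⊆ τ - v → del (_⊂ τ) v σ
      from′ σ⊆τ-v = y∉q⊆p-y σ⊆τ-v , p-y⊆p ∘ σ⊆τ-v , v , v∈τ , y∉q⊆p-y σ⊆τ-v

    del-⊂-facet⇒facet : ∀ σ → IsFacet (del (_⊂ τ) v) σ → IsFacet (_⊂ τ) σ
    del-⊂-facet⇒facet σ ((v∉σ , σ⊂τ) , maximal) = σ⊂τ , ρ⊆σ
      where
      τ-v⊆σ : τ - v ⊆ σ
      τ-v⊆σ = maximal (τ - v) (from (del-⊂ _) id) (to (del-⊂ σ) (v∉σ , σ⊂τ))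
      ρ⊆σ : ∀ ρ → ρ ⊂ τ → σ ⊆ ρ → ρ ⊆ σ
      ρ⊆σ ρ (ρ⊆τ , j , j∈τ , j∉ρ) σ⊆ρ x∈ρ with x∈p⇒x≡y⊎x∈p-y {y = v} (ρ⊆τ x∈ρ) | x∈p⇒x≡y⊎x∈p-y {y = v} j∈τ
      ... | inj₂ x∈τ-v | _          = τ-v⊆σ x∈τ-v
      ... | inj₁ refl  | inj₁ refl  = ⊥-elim (j∉ρ x∈ρ)
      ... | inj₁ refl  | inj₂ j∈τ-v = ⊥-elim (j∉ρ (σ⊆ρ (τ-v⊆σ j∈τ-v)))

⊂-vertexDecomposable : (τ : Subset n) → VertexDecomposable (_⊂ τ)
⊂-vertexDecomposable τ = go τ (<-wellFounded ∣ τ ∣)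
  where
  go : ∀ τ → Acc _<_ ∣ τ ∣ → VertexDecomposable (_⊂ τ)
  go τ (acc smaller) with nonempty? τ
  ... | no τ-empty = simplex (inj₁ (⊂-empty τ-empty))
  ... | yes (v , v∈τ) with nonempty? (τ - v)
  ...   | no τ-v-empty    = simplex (inj₂ (⊥ , ⊂-singleton v∈τ τ-v-empty))
  ...   | yes (_ , u∈τ-v) =
    shed v (⁅⁆⊂ v∈τ u∈τ-v)
      (VertexDecomposable-resp (≋-sym (lk-⊂ v∈τ)) (go (τ - v) (smaller (x∈p⇒∣p-x∣<∣p∣ v∈τ))))
      (simplex (inj₂ (τ - v , del-⊂ v∈τ)))
      (del-⊂-facet⇒facet v∈τ)

notFull⇒⊂⊤ : ∀ {n} {σ : Subset n} → ¬ (∀ i → i ∈ σ) → σ ⊂ ⊤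
notFull⇒⊂⊤ {n} {σ} notFull = ⊆⊤ , map₂ (∈⊤ ,_) (¬∀⟶∃¬ n (_∈ σ) (_∈? σ) notFull)

-- Paths and linear forests

module _ (D : Multidigraph) where

  private
    s = src D
    t = tgt D

  Chain-applyUpTo : ∀ (f : ℕ → Fin (nE D)) → (∀ x → t (f x) ≡ s (f (suc x)))
                  → ∀ k → Chain D (applyUpTo f k)
  Chain-applyUpTo f linked zero          = tt
  Chain-applyUpTo f linked (suc zero)    = tt
  Chain-applyUpTo f linked (suc (suc k)) = linked 0 , Chain-applyUpTo (f ∘ suc) (linked ∘ suc) (suc k)

  Chain⇒successor : ∀ {y ys z x} → Chain D ((y ∷ ys) ∷ʳ z) → x ∈ₗ y ∷ ys → Any (λ f → t x ≡ s f) (ys ∷ʳ z)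
  Chain⇒successor {ys = []}     (t≡s , _) (here refl) = here t≡s
  Chain⇒successor {ys = _ ∷ _} (t≡s , _) (here refl) = here t≡s
  Chain⇒successor {ys = _ ∷ _} (_ , chain) (there x∈) = there (Chain⇒successor chain x∈)

  src∈pathVerts : ∀ {e es g} → Chain D (e ∷ es) → g ∈ₗ e ∷ es → s g ∈ₗ pathVerts D e es
  src∈pathVerts _ (here refl) = here refl
  src∈pathVerts {es = _ ∷ _} (t≡s , chain) (there g∈) with src∈pathVerts chain g∈
  ... | here sg≡s = there (here (trans sg≡s (sym t≡s)))
  ... | there sg∈ = there (there sg∈)

  IsDirPath⇒sink : ∀ {e es} → IsDirPath D e es → ∃[ ℓ ] (ℓ ∈ₗ e ∷ es × ∀ {g} → g ∈ₗ e ∷ es → s g ≢ t ℓ)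
  IsDirPath⇒sink {e} {[]} (_ , (se∉ ∷ _)) = e , here refl , λ { (here refl) → All.head se∉ ; (there ()) }
  IsDirPath⇒sink {e} {e′ ∷ es} ((te≡se′ , chain) , (se∉ ∷ unique))
    with IsDirPath⇒sink (chain , subst (λ v → Unique (v ∷ map t (e′ ∷ es))) te≡se′ unique)
  ... | ℓ , ℓ∈ , ℓ-sink = ℓ , there ℓ∈ , λ where
      (here refl) → All.lookup (All.tail se∉) (∈-map⁺ t ℓ∈)
      (there g∈)  → ℓ-sink g∈

  Dlf⇒sink : ∀ {σ e} → Dlf D σ → e ∈ σ → ∃[ ℓ ] (ℓ ∈ σ × ∀ {g} → g ∈ σ → s g ≢ t ℓ)
  Dlf⇒sink ([] , _ , _ , covers) e∈σ with to (covers _) e∈σ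
  ... | ()
  Dlf⇒sink {σ} (P ∷ Ps , P-path ∷ paths , P-disjoint ∷ _ , covers) _ with IsDirPath⇒sink P-path
  ... | ℓ , ℓ∈P , ℓ-sink = ℓ , from (covers ℓ) (here ℓ∈P) , sink
    where
    tℓ∈P : t ℓ ∈ₗ pVerts D P
    tℓ∈P = there (∈-map⁺ t ℓ∈P)
    sink : ∀ {g} → g ∈ σ → s g ≢ t ℓ
    sink g∈σ with to (covers _) g∈σ
    ... | here g∈P   = ℓ-sink g∈P
    ... | there g∈Ps = outside (All.zip (P-disjoint , paths)) g∈Ps
      where
      outside : ∀ {Qs g} → All (λ Q → VertexDisjoint D P Q × IsDirPath D (proj₁ Q) (proj₂ Q)) Qs
              → Any (λ Q → g ∈ₗ pEdges D Q) Qs → s g ≢ t ℓ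
      outside {Q ∷ _} ((P-disj-Q , Q-chain , _) ∷ _) (here g∈Q) sg≡tℓ =
        P-disj-Q (t ℓ) tℓ∈P (subst (_∈ₗ pVerts D Q) sg≡tℓ (src∈pathVerts Q-chain g∈Q))
      outside (_ ∷ rest) (there g∈Qs) = outside rest g∈Qs

module _ (D : Multidigraph) (σ : Subset (nE D))
         (m : ℕ) (edge : ℕ → Fin (nE D)) (pos : Fin (nV D) → ℕ)
         (linked : ∀ x → tgt D (edge x) ≡ src D (edge (suc x)))
         (pos-src : ∀ {x} → x ≤ m → pos (src D (edge x)) ≡ x) where

  private
    s = src D
    t = tgt D

    Above : ℕ → DPath D → Set
    Above q P = ∀ v → v ∈ₗ pVerts D P → q ≤ pos v

    Above-weaken : ∀ {q P} → Above (suc q) P → Above q P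
    Above-weaken above v v∈ = ≤-trans (n≤1+n _) (above v v∈)

    separated : ∀ {q P Q} → (∀ v → v ∈ₗ pVerts D P → pos v < q) → Above q Q → VertexDisjoint D P Q
    separated below above v v∈P v∈Q = ≤⇒≯ (above v v∈Q) (below v v∈P)

    -- Only the first path may reach position p, and then it starts with edge p, so that
    -- edge (p ∸ 1) either extends it or starts a new path disjoint from all the others.
    HeadFrom : ℕ → List (DPath D) → Set
    HeadFrom p []       = ⊤ᵤ
    HeadFrom p (P ∷ Ps) = (proj₁ P ≡ edge p ⊎ Above (suc p) P) × All (Above (suc p)) Ps

    _∈ₑ_ : Fin (nE D) → List (DPath D) → Set
    e ∈ₑ Ps = Any (λ P → e ∈ₗ pEdges D P) Ps

    record Decomposes (p : ℕ) (Ps : List (DPath D)) : Set where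
      field
        paths    : All (λ P → IsDirPath D (proj₁ P) (proj₂ P)) Ps
        disjoint : AllPairs (VertexDisjoint D) Ps
        complete : ∀ {x} → p ≤ x → x < m → edge x ∈ σ → edge x ∈ₑ Ps
        sound    : ∀ {e} → e ∈ₑ Ps → e ∈ σ
        above    : All (Above p) Ps
        head     : HeadFrom p Ps
    open Decomposes

    empty : Decomposes m []
    empty = record
      { paths = [] ; disjoint = [] ; complete = λ m≤x x<m _ → ⊥-elim (≤⇒≯ m≤x x<m)
      ; sound = λ () ; above = [] ; head = tt }

    module _ {p : ℕ} (p<m : p < m) where

      pos-s : pos (s (edge p)) ≡ p
      pos-s = pos-src (<⇒≤ p<m)

      pos-t : pos (t (edge p)) ≡ suc p
      pos-t = trans (cong pos (linked p)) (pos-src p<m)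

      complete-extend : ∀ {Ps Qs} → (edge p ∈ σ → edge p ∈ₑ Qs) → (∀ {e} → e ∈ₑ Ps → e ∈ₑ Qs)
                      → (∀ {x} → suc p ≤ x → x < m → edge x ∈ σ → edge x ∈ₑ Ps)
                      → (∀ {x} → p ≤ x → x < m → edge x ∈ σ → edge x ∈ₑ Qs)
      complete-extend at-p mono complete p≤x x<m ex∈σ with m≤n⇒m<n∨m≡n p≤x
      ... | inj₁ p<x  = mono (complete p<x x<m ex∈σ)
      ... | inj₂ refl = at-p ex∈σ

      skip : ∀ {Ps} → edge p ∉ σ → Decomposes (suc p) Ps → Decomposes p Ps
      skip ep∉σ dec = record
        { paths = paths dec ; disjoint = disjoint dec
        ; complete = complete-extend (⊥-elim ∘ ep∉σ) (λ e∈ → e∈) (complete dec)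
        ; sound = sound dec
        ; above = All.map Above-weaken (above dec)
        ; head = head-above (above dec) }
        where
        head-above : ∀ {Ps} → All (Above (suc p)) Ps → HeadFrom p Ps
        head-above []       = tt
        head-above (a ∷ as) = inj₂ a , as

      single : DPath D
      single = edge p , []

      single-IsDirPath : IsDirPath D (edge p) []
      single-IsDirPath = tt , (s≢t ∷ []) ∷ [] ∷ []
        where
        s≢t : s (edge p) ≢ t (edge p)
        s≢t s≡t = <-irrefl (trans (sym pos-s) (trans (cong pos s≡t) pos-t)) ≤-refl

      single-between : ∀ v → v ∈ₗ pVerts D single → p ≤ pos v × pos v ≤ suc p
      single-between _ (here refl)         = ≤-reflexive (sym pos-s) , ≤-trans (≤-reflexive pos-s) (n≤1+n p)
      single-between _ (there (here refl)) = ≤-trans (n≤1+n p) (≤-reflexive (sym pos-t)) , ≤-reflexive pos-t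

      start : ∀ {Ps} → edge p ∈ σ → All (Above (suc (suc p))) Ps
            → Decomposes (suc p) Ps → Decomposes p (single ∷ Ps)
      start ep∈σ Ps-above dec = record
        { paths = single-IsDirPath ∷ paths dec
        ; disjoint = All.map (separated (λ v v∈ → s≤s (proj₂ (single-between v v∈)))) Ps-above ∷ disjoint dec
        ; complete = complete-extend (λ _ → here (here refl)) there (complete dec)
        ; sound = λ { (here (here refl)) → ep∈σ ; (here (there ())) ; (there e∈Ps) → sound dec e∈Ps }
        ; above = (λ v v∈ → proj₁ (single-between v v∈)) ∷ All.map Above-weaken (above dec)
        ; head = inj₁ refl , above dec }

      extend : ∀ {es Ps} → edge p ∈ σ → Decomposes (suc p) ((edge (suc p) , es) ∷ Ps)
             → Decomposes p ((edge p , edge (suc p) ∷ es) ∷ Ps)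
      extend {es} {Ps} ep∈σ dec with paths dec | disjoint dec | above dec | head dec
      ... | (P-chain , P-unique) ∷ Ps-paths | P-disjoint ∷ Ps-disjoint | P-above ∷ Ps-above | _ , Ps-above₂ = record
        { paths = ((linked p , P-chain) , subst Unique (sym verts-≡) (All.tabulate sp∉P ∷ P-unique)) ∷ Ps-paths
        ; disjoint = All.zipWith P′-disjoint (P-disjoint , Ps-above₂) ∷ Ps-disjoint
        ; complete = complete-extend (λ _ → here (here refl))
                       (λ { (here e∈P) → here (there e∈P) ; (there e∈Ps) → there e∈Ps }) (complete dec)
        ; sound = λ { (here (here refl)) → ep∈σ ; (here (there e∈P)) → sound dec (here e∈P)
                    ; (there e∈Ps) → sound dec (there e∈Ps) }
        ; above = P′-above ∷ All.map Above-weaken Ps-above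
        ; head = inj₁ refl , Ps-above }
        where
        P P′ : DPath D
        P  = edge (suc p) , es
        P′ = edge p , edge (suc p) ∷ es

        verts-≡ : pVerts D P′ ≡ s (edge p) ∷ pVerts D P
        verts-≡ = cong (λ v → s (edge p) ∷ v ∷ map t (edge (suc p) ∷ es)) (linked p)

        sp∉P : ∀ {v} → v ∈ₗ pVerts D P → s (edge p) ≢ v
        sp∉P v∈P refl = <-irrefl (sym pos-s) (P-above _ v∈P)

        P′-above : Above p P′
        P′-above v v∈P′ with subst (v ∈ₗ_) verts-≡ v∈P′
        ... | here refl = ≤-reflexive (sym pos-s)
        ... | there v∈P = Above-weaken P-above v v∈P

        P′-disjoint : ∀ {R} → VertexDisjoint D P R × Above (suc (suc p)) R → VertexDisjoint D P′ R
        P′-disjoint (P-disj-R , R-above) v v∈P′ v∈R with subst (v ∈ₗ_) verts-≡ v∈P′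
        ... | here refl = ≤⇒≯ (R-above v v∈R) (s≤s (≤-trans (≤-reflexive pos-s) (n≤1+n p)))
        ... | there v∈P = P-disj-R v v∈P v∈R

      include : ∀ {Ps} → edge p ∈ σ → Decomposes (suc p) Ps → ∃ (Decomposes p)
      include {[]} ep∈σ dec = _ , start ep∈σ [] dec
      include {(e , es) ∷ Ps} ep∈σ dec with e ≟ edge (suc p) | head dec
      ... | yes refl | _                     = _ , extend ep∈σ dec
      ... | no e≢    | inj₁ e≡ , _           = ⊥-elim (e≢ e≡)
      ... | no _     | inj₂ P-above , Ps-above = _ , start ep∈σ (P-above ∷ Ps-above) dec

      step : ∀ {Ps} → Decomposes (suc p) Ps → ∃ (Decomposes p)
      step dec with edge p ∈? σ
      ... | no  ep∉σ = _ , skip ep∉σ dec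
      ... | yes ep∈σ = include ep∈σ dec

    decompose : ∀ d {p} → d + p ≡ m → ∃ (Decomposes p)
    decompose zero    refl       = _ , empty
    decompose (suc d) {p} d+p≡m = step p<m (proj₂ (decompose d (trans (+-suc d p) d+p≡m)))
      where
      p<m : p < m
      p<m = ≤-trans (s≤s (m≤n+m p d)) (≤-reflexive d+p≡m)

  walkPrefix⇒Dlf : (∀ {e} → e ∈ σ → ∃[ x ] (x < m × edge x ≡ e)) → Dlf D σ
  walkPrefix⇒Dlf σ⊆walk with decompose m (+-identityʳ m)
  ... | Ps , dec = Ps , paths dec , disjoint dec , λ e → mk⇔ covered (sound dec)
    where
    covered : ∀ {e} → e ∈ σ → e ∈ₑ Ps
    covered e∈σ with σ⊆walk e∈σ
    ... | x , x<m , refl = complete dec z≤n x<m e∈σ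

-- The directed cycle

module Cycle (n : ℕ) where

  private
    N = suc n
    C = cycleDigraph N

  next : Fin N → Fin N
  next = tgt C

  walk : Fin N → ℕ → Fin N
  walk e x = (toℕ e + x) mod N

  offset : Fin N → Fin N → ℕ
  offset e v = (toℕ v + (N ∸ toℕ e)) % N

  toℕ-mod : ∀ a → toℕ (a mod N) ≡ a % N
  toℕ-mod a = toℕ-fromℕ< (m%n<n a N)

  toℕ%N : ∀ (v : Fin N) → toℕ v % N ≡ toℕ v
  toℕ%N v = m<n⇒m%n≡m (toℕ<n v)

  walk-zero : ∀ e → walk e 0 ≡ e
  walk-zero e = toℕ-injective (begin
    toℕ (walk e 0)   ≡⟨ toℕ-mod (toℕ e + 0) ⟩
    (toℕ e + 0) % N  ≡⟨ cong (_% N) (+-identityʳ (toℕ e)) ⟩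
    toℕ e % N        ≡⟨ toℕ%N e ⟩
    toℕ e            ∎)

  walk-N : ∀ e → walk e N ≡ e
  walk-N e = toℕ-injective (begin
    toℕ (walk e N)   ≡⟨ toℕ-mod (toℕ e + N) ⟩
    (toℕ e + N) % N  ≡⟨ [m+n]%n≡m%n (toℕ e) N ⟩
    toℕ e % N        ≡⟨ toℕ%N e ⟩
    toℕ e            ∎)

  walk-suc : ∀ e x → next (walk e x) ≡ walk e (suc x)
  walk-suc e x = toℕ-injective (begin
    toℕ (next (walk e x))       ≡⟨ toℕ-mod (suc (toℕ (walk e x))) ⟩
    (1 + toℕ (walk e x)) % N    ≡⟨ cong (λ a → (1 + a) % N) (toℕ-mod (toℕ e + x)) ⟩
    (1 + (toℕ e + x) % N) % N   ≡⟨ [m+n%d]%d≡[m+n]%d 1 (toℕ e + x) N ⟩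
    suc (toℕ e + x) % N         ≡⟨ cong (_% N) (+-suc (toℕ e) x) ⟨
    (toℕ e + suc x) % N         ≡⟨ toℕ-mod (toℕ e + suc x) ⟨
    toℕ (walk e (suc x))        ∎)

  walk-next : ∀ e x → walk (next e) x ≡ walk e (suc x)
  walk-next e x = toℕ-injective (begin
    toℕ (walk (next e) x)          ≡⟨ toℕ-mod (toℕ (next e) + x) ⟩
    (toℕ (next e) + x) % N         ≡⟨ cong (λ a → (a + x) % N) (toℕ-mod (suc (toℕ e))) ⟩
    (suc (toℕ e) % N + x) % N      ≡⟨ [m%d+n]%d≡[m+n]%d (suc (toℕ e)) x N ⟩
    suc (toℕ e + x) % N            ≡⟨ cong (_% N) (+-suc (toℕ e) x) ⟨
    (toℕ e + suc x) % N            ≡⟨ toℕ-mod (toℕ e + suc x) ⟨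
    toℕ (walk e (suc x))           ∎)

  offset<N : ∀ e v → offset e v < N
  offset<N e v = m%n<n (toℕ v + (N ∸ toℕ e)) N

  walk-offset : ∀ e v → walk e (offset e v) ≡ v
  walk-offset e v = toℕ-injective (begin
    toℕ (walk e (offset e v))                   ≡⟨ toℕ-mod (toℕ e + offset e v) ⟩
    (toℕ e + (toℕ v + (N ∸ toℕ e)) % N) % N     ≡⟨ [m+n%d]%d≡[m+n]%d (toℕ e) (toℕ v + (N ∸ toℕ e)) N ⟩
    (toℕ e + (toℕ v + (N ∸ toℕ e))) % N         ≡⟨ cong (_% N) (m+[k+[n∸m]]≡k+n (<⇒≤ (toℕ<n e)) (toℕ v)) ⟩
    (toℕ v + N) % N                             ≡⟨ [m+n]%n≡m%n (toℕ v) N ⟩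
    toℕ v % N                                   ≡⟨ toℕ%N v ⟩
    toℕ v                                       ∎)

  offset-walk : ∀ e {x} → x < N → offset e (walk e x) ≡ x
  offset-walk e {x} x<N = begin
    (toℕ (walk e x) + (N ∸ toℕ e)) % N    ≡⟨ cong (λ a → (a + (N ∸ toℕ e)) % N) (toℕ-mod (toℕ e + x)) ⟩
    ((toℕ e + x) % N + (N ∸ toℕ e)) % N   ≡⟨ [m%d+n]%d≡[m+n]%d (toℕ e + x) (N ∸ toℕ e) N ⟩
    (toℕ e + x + (N ∸ toℕ e)) % N         ≡⟨ cong (_% N) (+-assoc (toℕ e) x (N ∸ toℕ e)) ⟩
    (toℕ e + (x + (N ∸ toℕ e))) % N       ≡⟨ cong (_% N) (m+[k+[n∸m]]≡k+n (<⇒≤ (toℕ<n e)) x) ⟩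
    (x + N) % N                           ≡⟨ [m+n]%n≡m%n x N ⟩
    x % N                                 ≡⟨ m<n⇒m%n≡m x<N ⟩
    x                                     ∎

  walk-injective : ∀ e {x y} → x < N → y < N → walk e x ≡ walk e y → x ≡ y
  walk-injective e {x} {y} x<N y<N walk-x≡walk-y = begin
    x                    ≡⟨ offset-walk e x<N ⟨
    offset e (walk e x)  ≡⟨ cong (offset e) walk-x≡walk-y ⟩
    offset e (walk e y)  ≡⟨ offset-walk e y<N ⟩
    y                    ∎

  walk-next-n : ∀ e → walk (next e) n ≡ e
  walk-next-n e = trans (walk-next e n) (walk-N e)

  next-injective : ∀ {e f} → next e ≡ next f → e ≡ f
  next-injective {e} {f} next-e≡next-f = begin
    e                  ≡⟨ walk-next-n e ⟨
    walk (next e) n    ≡⟨ cong (λ v → walk v n) next-e≡next-f ⟩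
    walk (next f) n    ≡⟨ walk-next-n f ⟩
    f                  ∎

  full⇒HasDirCycle : ∀ {σ} → (∀ i → i ∈ σ) → HasDirCycle C σ
  full⇒HasDirCycle full =
    w 0 , applyUpTo (w ∘ suc) n , (closed-chain , unique) , full _ , All.tabulate (λ {i} _ → full i)
    where
    w : ℕ → Fin N
    w = walk zero

    w-closes : applyUpTo w (suc N) ≡ applyUpTo w N ∷ʳ w 0
    w-closes = begin
      applyUpTo w (suc N)    ≡⟨ applyUpTo-∷ʳ w N ⟨
      applyUpTo w N ∷ʳ w N   ≡⟨ cong (applyUpTo w N ∷ʳ_) (trans (walk-N zero) (sym (walk-zero zero))) ⟩
      applyUpTo w N ∷ʳ w 0   ∎

    closed-chain : Chain C (applyUpTo w N ∷ʳ w 0)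
    closed-chain = subst (Chain C) w-closes (Chain-applyUpTo C w (walk-suc zero) (suc N))

    unique : Unique (map (src C) (applyUpTo w N))
    unique = subst Unique (sym (map-id _))
               (applyUpTo⁺₁ w N λ i<j j<N → <⇒≢ i<j ∘ walk-injective zero (<-trans i<j j<N) j<N)

  HasDirCycle⇒full : ∀ {σ} → HasDirCycle C σ → ∀ i → i ∈ σ
  HasDirCycle⇒full {σ} (e , es , (chain , _) , e∈σ , es⊆σ) i =
    ∈σ (subst (_∈ₗ e ∷ es) (walk-offset e i) (walk∈ (offset e i)))
    where
    walk∈ : ∀ x → walk e x ∈ₗ e ∷ es
    walk∈ zero    = subst (_∈ₗ e ∷ es) (sym (walk-zero e)) (here refl)
    walk∈ (suc x) = subst (_∈ₗ e ∷ es) (walk-suc e x)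
                      (∈-resp-↭ (↭-sym (∷↭∷ʳ e es)) (Chain⇒successor C chain (walk∈ x)))
    ∈σ : ∀ {x} → x ∈ₗ e ∷ es → x ∈ σ
    ∈σ (here refl)  = e∈σ
    ∈σ (there x∈es) = All.lookup es⊆σ x∈es

  Dlf⇒notFull : ∀ {σ} → Dlf C σ → ¬ (∀ i → i ∈ σ)
  -- The sink next ℓ is the source of the edge next ℓ.
  Dlf⇒notFull dlf full with Dlf⇒sink C dlf (full zero)
  ... | ℓ , _ , ℓ-sink = ℓ-sink (full (next ℓ)) refl

  ∉⇒Dlf : ∀ {σ i} → i ∉ σ → Dlf C σ
  ∉⇒Dlf {σ} {i} i∉σ = walkPrefix⇒Dlf C σ n (walk (next i)) (offset (next i))
                        (walk-suc (next i)) (offset-walk (next i) ∘ s≤s) σ⊆walk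
    where
    σ⊆walk : ∀ {e} → e ∈ σ → ∃[ x ] (x < n × walk (next i) x ≡ e)
    σ⊆walk {e} e∈σ with m≤n⇒m<n∨m≡n (s≤s⁻¹ (offset<N (next i) e))
    ... | inj₁ x<n = offset (next i) e , x<n , walk-offset (next i) e
    ... | inj₂ x≡n = ⊥-elim (i∉σ (subst (_∈ σ) e≡i e∈σ))
      where
      e≡i : e ≡ i
      e≡i = begin
        e                                    ≡⟨ walk-offset (next i) e ⟨
        walk (next i) (offset (next i) e)    ≡⟨ cong (walk (next i)) x≡n ⟩
        walk (next i) n                      ≡⟨ walk-next-n i ⟩
        i                                    ∎

  Dlf≋⊂⊤ : Dlf C ≋ (_⊂ ⊤)
  Dlf≋⊂⊤ σ = mk⇔ (notFull⇒⊂⊤ ∘ Dlf⇒notFull) (λ (_ , _ , _ , i∉σ) → ∉⇒Dlf i∉σ)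

  DT≋⊂⊤ : DT C ≋ (_⊂ ⊤)
  DT≋⊂⊤ σ = mk⇔ (λ (acyclic , _) → notFull⇒⊂⊤ (acyclic ∘ full⇒HasDirCycle))
                (λ (_ , i , _ , i∉σ) → (λ cycle → i∉σ (HasDirCycle⇒full cycle i))
                                     , λ _ _ _ _ → next-injective)

lemma2p11 : (n : ℕ) .{{_ : NonZero n}}
    → (∀ σ → Dlf (cycleDigraph n) σ ⇔ DT (cycleDigraph n) σ)
      × VertexDecomposable (Dlf (cycleDigraph n))
lemma2p11 (suc n) = (λ σ → ⇔-sym (DT≋⊂⊤ σ) ⇔-∘ Dlf≋⊂⊤ σ)
                  , VertexDecomposable-resp (≋-sym Dlf≋⊂⊤) (⊂-vertexDecomposable ⊤)
  where open Cycle n
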